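{- Let $P_n$ and $C_n$ denote the path and the cycle on $n\ge3$ vertices. Then $t(P_n)\le t(C_n)\le 3k$ if $n\in(2\cdot3^{k-1},3^k]$ for some integer $k\ge1$; $t(P_n)\le t(C_n)\le 3k+1$ if $n\in(3^k,4\cdot3^{k-1}]$ for some integer $k\ge1$; and $t(P_n)\le t(C_n)\le 3k+2$ if $n\in(4\cdot3^{k-1},2\cdot3^k]$ for some integer $k\ge1$.
   Context: For a finite simple graph $G$, a $G$-CFF$(t,|V(G)|)$ is a family of subsets $B_v\subseteq[1,t]=\{1,\dots,t\}$, one for each vertex $v$, such that for every edge $\{a,b\}$: (i) $B_a\not\subseteq B_b$ and $B_b\not\subseteq B_a$, and (ii) for every vertex $w\notin\{a,b\}$, $B_w\not\subseteq B_a\cup B_b$. $t(G)$ is the minimum $t$ for which a $G$-CFF$(t,|V(G)|)$ exists. Intervals $(a,b]$ denote sets of integers $n$ with $a<n\le b$. -}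

module Defs where

open import Data.Nat using (ℕ; suc; _≤_)
open import Data.Fin using (Fin; toℕ)
open import Data.Fin.Subset using (Subset; _⊆_; _∪_)
open import Data.Product using (Σ; _×_)
open import Data.Sum using (_⊎_)
open import Relation.Binary.PropositionalEquality using (_≡_; _≢_)
open import Relation.Nullary using (¬_)

-- A finite simple graph on vertex set Fin n, given by its (symmetric,
-- irreflexive) adjacency relation.
Graph : ℕ → Set₁
Graph n = Fin n → Fin n → Set

Path : (n : ℕ) → Graph n
Path n i j = (suc (toℕ i) ≡ toℕ j) ⊎ (suc (toℕ j) ≡ toℕ i)

Cycle : (n : ℕ) → Graph n
Cycle n i j = Path n i j
            ⊎ ((toℕ i ≡ 0) × (suc (toℕ j) ≡ n))
            ⊎ ((toℕ j ≡ 0) × (suc (toℕ i) ≡ n))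

-- A G-CFF(t,|V(G)|): a family B_v ⊆ [1,t] (encoded as subsets of Fin t).
IsGCFF : {n : ℕ} → Graph n → (t : ℕ) → (Fin n → Subset t) → Set
IsGCFF {n} G t B =
  ∀ (a b : Fin n) → G a b →
    (¬ (B a ⊆ B b)) × (¬ (B b ⊆ B a)) ×
    (∀ (w : Fin n) → w ≢ a → w ≢ b → ¬ (B w ⊆ (B a ∪ B b)))

HasGCFF : {n : ℕ} → Graph n → ℕ → Set
HasGCFF {n} G t = Σ (Fin n → Subset t) (IsGCFF G t)

IsTG : {n : ℕ} → Graph n → ℕ → Set
IsTG G m = HasGCFF G m × (∀ t → HasGCFF G t → m ≤ t)

module Submission where

-- A C_m-CFF B on t points is an antichain (every vertex of a cycle has a neighbour) and is also a
-- P_m-CFF, so giving the vertex (c, i) of K_3 □ P_m the set {c} ⊎ B_i yields a CFF for K_3 □ P_m on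
-- 3 + t points. For 2m ≤ n ≤ 3m the cycle C_n embeds in K_3 □ P_m (out along two layers, using both
-- of them at n − 2m positions, and back along the third), and CFFs pull back along embeddings, so
-- t(C_n) ≤ t(C_m) + 3. Starting from t(C_3) ≤ 3, t(C_4) ≤ 4 and t(C_5), t(C_6) ≤ 5 and always taking
-- m to be the top of the previous interval covers the three families of intervals. Finally P_n is a
-- spanning subgraph of C_n, so t(P_n) ≤ t(C_n).

open import Defs
open import Data.Nat using (ℕ; zero; suc; _+_; _*_; _∸_; _^_; _≤_; _<_; z≤n; s≤s; _<?_; _≤?_)
import Data.Nat as ℕ
open import Data.Nat.Properties
  using (suc-injective; +-suc; +-comm; +-identityʳ; *-identityʳ; *-assoc; *-suc; ≤-refl; ≤-antisym;
         ≤-reflexive; ≤-trans; ≤-pred; ≮⇒≥; m≤n⇒m<n∨m≡n; ∸-monoˡ-≤; m+n∸m≡n; m+[n∸m]≡n; *-monoˡ-≤;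
         *-monoˡ-<; m^n≢0; module ≤-Reasoning)
open import Data.Nat.Tactic.RingSolver using (solve-∀)
open import Data.Bool using (Bool; true; false; not; _∨_)
open import Data.Maybe using (just)
import Data.Maybe as Maybe
open import Data.Maybe.Properties using (just-injective)
open import Data.Fin using (Fin; zero; suc; toℕ; fromℕ<; #_)
import Data.Fin as Fin
open import Data.Fin.Properties using (toℕ-fromℕ<; toℕ<n; all?)
open import Data.Fin.Subset using (Subset; _⊆_; _∪_; ⁅_⁆) renaming (_∈_ to _∈ₛ_)
open import Data.Fin.Subset.Properties
  using (x∈⁅x⁆; x∈⁅y⁆⇒x≡y; x∈p∪q⁻; p⊆p∪q; ∪-idem; drop-∷-⊆; _⊆?_)
open import Data.Vec using ([]; _∷_; here; there)
import Data.Vec as Vec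
open import Data.Vec.Properties using (zipWith-++)
open import Data.List using (List; []; _∷_; [_]; _++_; _∷ʳ_; map; length; lookup; last)
open import Data.List.Properties using (length-++; length-map; last-map)
open import Data.List.Membership.Propositional using (_∈_)
open import Data.List.Membership.Propositional.Properties using (∈-lookup)
open import Data.List.Relation.Unary.Any using (here)
open import Data.List.Relation.Unary.All using (All; []; _∷_; universal)
import Data.List.Relation.Unary.All as All
import Data.List.Relation.Unary.All.Properties as All
open import Data.List.Relation.Unary.AllPairs using ([]; _∷_)
open import Data.List.Relation.Unary.Unique.Propositional using (Unique)
import Data.List.Relation.Unary.Unique.Propositional.Properties as Unique
open import Data.List.Relation.Unary.Linked using (Linked; []; [-]; _∷_)
import Data.List.Relation.Unary.Linked as Linked
import Data.List.Relation.Unary.Linked.Properties as Linked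
open import Data.Product using (∃; _×_; _,_; proj₁; proj₂)
import Data.Product as Product
open import Data.Sum using (_⊎_; inj₁; inj₂)
import Data.Sum as Sum
open import Data.Empty using (⊥-elim)
open import Function using (_∘_; id)
open import Relation.Nullary using (¬_; yes; no; Dec; ¬?)
open import Relation.Nullary.Decidable using (_×-dec_; _⊎-dec_; _→-dec_; from-yes)
open import Relation.Binary using (Symmetric; DecidableEquality)
open import Relation.Binary.PropositionalEquality
  using (_≡_; _≢_; refl; sym; trans; cong; cong₂; subst; subst₂; module ≡-Reasoning)

-- IsGCFF for graphs on an arbitrary vertex type; IsGCFF G is definitionally IsCFF G.
IsCFF : {V : Set} → (V → V → Set) → (t : ℕ) → (V → Subset t) → Set
IsCFF {V} E t B =
  ∀ (a b : V) → E a b →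
    (¬ (B a ⊆ B b)) × (¬ (B b ⊆ B a)) ×
    (∀ (w : V) → w ≢ a → w ≢ b → ¬ (B w ⊆ (B a ∪ B b)))

IsAntichain : {V : Set} {t : ℕ} → (V → Subset t) → Set
IsAntichain B = ∀ {a b} → B a ⊆ B b → a ≡ b

module _ {V W : Set} {E : V → V → Set} {F : W → W → Set} {t : ℕ} {B : W → Subset t} where

  IsCFF-comap : (f : V → W) → (∀ {a b} → f a ≡ f b → a ≡ b) →
                (∀ {a b} → E a b → F (f a) (f b)) → IsCFF F t B → IsCFF E t (B ∘ f)
  IsCFF-comap f f-injective f-hom cff a b ab =
    let a⊈b , b⊈a , w⊈a∪b = cff (f a) (f b) (f-hom ab)
    in a⊈b , b⊈a , λ w w≢a w≢b → w⊈a∪b (f w) (w≢a ∘ f-injective) (w≢b ∘ f-injective)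

module _ {V : Set} {E : V → V → Set} {t : ℕ} {B : V → Subset t} where

  IsCFF⇒IsAntichain : DecidableEquality V → (∀ a → ∃ (E a)) → IsCFF E t B → IsAntichain B
  IsCFF⇒IsAntichain _≟_ neighbour cff {a} {b} a⊆b with a ≟ b | neighbour b
  ... | yes a≡b | _      = a≡b
  ... | no a≢b  | c , bc with a ≟ c
  ...   | yes refl = ⊥-elim (proj₁ (proj₂ (cff b c bc)) a⊆b)
  ...   | no a≢c   = ⊥-elim (proj₂ (proj₂ (cff b c bc)) a a≢b a≢c (p⊆p∪q (B c) ∘ a⊆b))

++-⊆⁻ : ∀ {s t} (u v : Subset s) {p q : Subset t} → u Vec.++ p ⊆ v Vec.++ q → u ⊆ v × p ⊆ q
++-⊆⁻ []      []      p⊆q = (λ ()) , p⊆q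
++-⊆⁻ (_ ∷ u) (_ ∷ v) ⊆   =
  let u⊆v , p⊆q = ++-⊆⁻ u v (drop-∷-⊆ ⊆)
  in (λ { here → zero∈-tail-irrelevant (⊆ here) ; (there x∈u) → there (u⊆v x∈u) }) , p⊆q
  where
  zero∈-tail-irrelevant : ∀ {m n s} {p : Subset m} {q : Subset n} → zero ∈ₛ s ∷ p → zero ∈ₛ s ∷ q
  zero∈-tail-irrelevant here = here

⁅⁆⊆⁅⁆⇒≡ : ∀ {n} {x y : Fin n} → ⁅ x ⁆ ⊆ ⁅ y ⁆ → x ≡ y
⁅⁆⊆⁅⁆⇒≡ {x = x} {y} ⊆ = x∈⁅y⁆⇒x≡y y (⊆ (x∈⁅x⁆ x))

⁅⁆⊆⁅⁆∪⁅⁆⇒≡⊎≡ : ∀ {n} {x y z : Fin n} → ⁅ x ⁆ ⊆ ⁅ y ⁆ ∪ ⁅ z ⁆ → x ≡ y ⊎ x ≡ z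
⁅⁆⊆⁅⁆∪⁅⁆⇒≡⊎≡ {x = x} {y} {z} ⊆ =
  Sum.map (x∈⁅y⁆⇒x≡y y) (x∈⁅y⁆⇒x≡y z) (x∈p∪q⁻ ⁅ y ⁆ ⁅ z ⁆ (⊆ (x∈⁅x⁆ x)))

K_□_ : {V : Set} (s : ℕ) → (V → V → Set) → Fin s × V → Fin s × V → Set
(K s □ E) (c , i) (d , j) = (c ≢ d × i ≡ j) ⊎ (c ≡ d × E i j)

module _ {V : Set} (s : ℕ) {t : ℕ} (B : V → Subset t) where

  layered : Fin s × V → Subset (s + t)
  layered (c , i) = ⁅ c ⁆ Vec.++ B i

  layered-⊆ : ∀ {c d i j} → layered (c , i) ⊆ layered (d , j) → c ≡ d × B i ⊆ B j
  layered-⊆ {c} {d} = Product.map₁ ⁅⁆⊆⁅⁆⇒≡ ∘ ++-⊆⁻ ⁅ c ⁆ ⁅ d ⁆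

  layered-⊆-∪ : ∀ {c d e i j k} → layered (e , k) ⊆ layered (c , i) ∪ layered (d , j) →
                (e ≡ c ⊎ e ≡ d) × B k ⊆ B i ∪ B j
  layered-⊆-∪ {c} {d} {e} {i} {j} ⊆ rewrite zipWith-++ _∨_ ⁅ c ⁆ (B i) ⁅ d ⁆ (B j) =
    Product.map₁ ⁅⁆⊆⁅⁆∪⁅⁆⇒≡⊎≡ (++-⊆⁻ ⁅ e ⁆ (⁅ c ⁆ ∪ ⁅ d ⁆) ⊆)

module _ {V : Set} {E : V → V → Set} (s : ℕ) where

  K□-sym : Symmetric E → Symmetric (K s □ E)
  K□-sym _     (inj₁ (c≢d , i≡j)) = inj₁ (c≢d ∘ sym , sym i≡j)
  K□-sym E-sym (inj₂ (c≡d , ij))  = inj₂ (sym c≡d , E-sym ij)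

  ≢⇒≢-position : ∀ {c e : Fin s} {i k : V} → (e , k) ≢ (c , i) → e ≡ c → k ≢ i
  ≢⇒≢-position w≢ e≡c k≡i = w≢ (cong₂ _,_ e≡c k≡i)

  module _ {t : ℕ} (B : V → Subset t) where

    IsCFF-K□ : IsAntichain B → IsCFF E t B → IsCFF (K s □ E) (s + t) (layered s B)
    IsCFF-K□ antichain cff (c , i) (d , .i) (inj₁ (c≢d , refl)) =
        c≢d ∘ proj₁ ∘ layered-⊆ s B
      , c≢d ∘ sym ∘ proj₁ ∘ layered-⊆ s B
      , λ { (e , k) w≢a w≢b ⊆ →
            let e≡c⊎e≡d , k⊆i∪i = layered-⊆-∪ s B ⊆
                k≡i = antichain (subst (B k ⊆_) (∪-idem (B i)) k⊆i∪i)
            in Sum.[ (λ e≡c → ≢⇒≢-position w≢a e≡c k≡i) , (λ e≡d → ≢⇒≢-position w≢b e≡d k≡i) ]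
                 e≡c⊎e≡d }
    IsCFF-K□ antichain cff (c , i) (.c , j) (inj₂ (refl , ij)) =
      let i⊈j , j⊈i , k⊈i∪j = cff i j ij
      in  i⊈j ∘ proj₂ ∘ layered-⊆ s B
        , j⊈i ∘ proj₂ ∘ layered-⊆ s B
        , λ { (e , k) w≢a w≢b ⊆ →
              let e≡c⊎e≡c , k⊆i∪j = layered-⊆-∪ s B ⊆
                  e≡c = Sum.reduce e≡c⊎e≡c
              in k⊈i∪j k (≢⇒≢-position w≢a e≡c) (≢⇒≢-position w≢b e≡c) k⊆i∪j }

Path-sym : ∀ {n} → Symmetric (Path n)
Path-sym = Sum.swap

Cycle-neighbour : ∀ {n} (i : Fin n) → ∃ (Cycle n i)
Cycle-neighbour {suc n} i with suc (toℕ i) <? suc n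
... | yes i+1<n = fromℕ< i+1<n , inj₁ (inj₁ (sym (toℕ-fromℕ< i+1<n)))
... | no  i+1≮n = zero , inj₂ (inj₂ (refl , ≤-antisym (toℕ<n i) (≮⇒≥ i+1≮n)))

Cycle? : ∀ n (a b : Fin n) → Dec (Cycle n a b)
Cycle? n a b =
  ((suc (toℕ a) ℕ.≟ toℕ b) ⊎-dec (suc (toℕ b) ℕ.≟ toℕ a))
  ⊎-dec (((toℕ a ℕ.≟ 0) ×-dec (suc (toℕ b) ℕ.≟ n)) ⊎-dec ((toℕ b ℕ.≟ 0) ×-dec (suc (toℕ a) ℕ.≟ n)))

IsGCFF? : ∀ {n} {G : Graph n} → (∀ a b → Dec (G a b)) → ∀ t (B : Fin n → Subset t) →
          Dec (IsGCFF G t B)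
IsGCFF? G? t B = all? λ a → all? λ b → G? a b →-dec
  (¬? (B a ⊆? B b) ×-dec ¬? (B b ⊆? B a) ×-dec
    all? λ w → ¬? (w Fin.≟ a) →-dec ¬? (w Fin.≟ b) →-dec ¬? (B w ⊆? (B a ∪ B b)))

module _ {A : Set} where

  lookup-injective : ∀ {xs : List A} → Unique xs → ∀ {i j} → lookup xs i ≡ lookup xs j → i ≡ j
  lookup-injective (_  ∷ _) {zero}  {zero}  _  = refl
  lookup-injective (x∉ ∷ _) {zero}  {suc j} x≡ = ⊥-elim (All.lookup x∉ (∈-lookup j) x≡)
  lookup-injective (x∉ ∷ _) {suc i} {zero}  ≡x = ⊥-elim (All.lookup x∉ (∈-lookup i) (sym ≡x))
  lookup-injective (_  ∷ u) {suc i} {suc j} eq = cong suc (lookup-injective u eq)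

  last-∷ʳ : ∀ (xs : List A) {x} → last (xs ∷ʳ x) ≡ just x
  last-∷ʳ []           = refl
  last-∷ʳ (_ ∷ [])     = refl
  last-∷ʳ (_ ∷ y ∷ ys) = last-∷ʳ (y ∷ ys)

  lookup-last : ∀ (xs : List A) {i} → suc (toℕ i) ≡ length xs → last xs ≡ just (lookup xs i)
  lookup-last (_ ∷ [])     {zero}  _       = refl
  lookup-last (_ ∷ y ∷ ys) {suc i} i+2≡len = lookup-last (y ∷ ys) (suc-injective i+2≡len)

  module _ {E : A → A → Set} where

    Linked-∷ʳ : ∀ {xs x y} → Linked E xs → last xs ≡ just x → E x y → Linked E (xs ∷ʳ y)
    Linked-∷ʳ [-]      refl   xy = xy ∷ [-]
    Linked-∷ʳ (e ∷ es) last≡x xy = e ∷ Linked-∷ʳ es last≡x xy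

    Linked-lookup : ∀ {xs} → Linked E xs →
                    ∀ {i j} → suc (toℕ i) ≡ toℕ j → E (lookup xs i) (lookup xs j)
    Linked-lookup (e ∷ _)  {zero}  {suc zero}    _     = e
    Linked-lookup (_ ∷ es) {suc i} {suc j}       i+1≡j = Linked-lookup es (suc-injective i+1≡j)
    Linked-lookup [-]      {zero}  {zero}        ()
    Linked-lookup (_ ∷ _)  {zero}  {zero}        ()
    Linked-lookup (_ ∷ _)  {zero}  {suc (suc _)} ()
    Linked-lookup (_ ∷ _)  {suc _} {zero}        ()

    -- Linked E (y ∷ xs) together with last xs ≡ just y says that xs, read cyclically, is a closed walk.
    closing-edge : ∀ {y xs} → Linked E (y ∷ xs) → last xs ≡ just y →
                   ∀ {i j} → suc (toℕ i) ≡ length xs → toℕ j ≡ 0 → E (lookup xs i) (lookup xs j)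
    closing-edge {xs = xs@(_ ∷ _)} es last≡y {j = zero} i+1≡n _ =
      subst (λ v → E v _) (just-injective (trans (sym last≡y) (lookup-last xs i+1≡n))) (Linked.head es)

    closed-walk-hom : Symmetric E → ∀ {y xs} → Linked E (y ∷ xs) → last xs ≡ just y →
                      ∀ {i j} → Cycle (length xs) i j → E (lookup xs i) (lookup xs j)
    closed-walk-hom _     es _      (inj₁ (inj₁ i+1≡j)) = Linked-lookup (Linked.tail es) i+1≡j
    closed-walk-hom E-sym es _      (inj₁ (inj₂ j+1≡i)) = E-sym (Linked-lookup (Linked.tail es) j+1≡i)
    closed-walk-hom E-sym es last≡y (inj₂ (inj₁ (i≡0 , j+1≡n))) =
      E-sym (closing-edge es last≡y j+1≡n i≡0)
    closed-walk-hom _     es last≡y (inj₂ (inj₂ (j≡0 , i+1≡n))) = closing-edge es last≡y i+1≡n j≡0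

middle : Fin 3
middle = suc zero

outer : Bool → Fin 3
outer false = zero
outer true  = suc (suc zero)

outer≢middle : ∀ b → outer b ≢ middle
outer≢middle false ()
outer≢middle true  ()

outer≢outer-not : ∀ b → outer b ≢ outer (not b)
outer≢outer-not false ()
outer≢outer-not true  ()

rung : ∀ {m} {c d : Fin 3} {i : Fin m} → c ≢ d → (K 3 □ Path m) (c , i) (d , i)
rung c≢d = inj₁ (c≢d , refl)

rail : ∀ {m} {c : Fin 3} {i j : Fin m} → Path m i j → (K 3 □ Path m) (c , i) (c , j)
rail ij = inj₂ (refl , ij)

shift : ∀ {m} → Fin 3 × Fin m → Fin 3 × Fin (suc m)
shift = Product.map₂ suc

shift-injective : ∀ {m} {u v : Fin 3 × Fin m} → shift u ≡ shift v → u ≡ v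
shift-injective refl = refl

shift-hom : ∀ {m} {u v : Fin 3 × Fin m} →
            (K 3 □ Path m) u v → (K 3 □ Path (suc m)) (shift u) (shift v)
shift-hom (inj₁ (c≢d , i≡j)) = inj₁ (c≢d , cong suc i≡j)
shift-hom (inj₂ (c≡d , ij))  = inj₂ (c≡d , Sum.map (cong suc) (cong suc) ij)

column : ∀ {m} → Bool → ℕ → List (Fin 3 × Fin (suc m))
column b r = (outer b , zero) ∷ doubling r
  where
  doubling : ℕ → List (Fin 3 × Fin _)
  doubling zero    = []
  doubling (suc _) = [ outer (not b) , zero ]

exit : Bool → ℕ → Bool
exit b zero    = b
exit b (suc _) = not b

-- For r ≤ m, a closed walk through 2m + r distinct vertices of K 3 □ Path m: out along the outer
-- layers, starting on layer (outer b) and taking both outer layers at each of the first r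
-- positions, then back along the middle layer.
ring : Bool → ℕ → (m : ℕ) → List (Fin 3 × Fin m)
ring _ _ zero    = []
ring b r (suc m) = (column b r ++ map shift (ring (exit b r) (ℕ.pred r) m)) ∷ʳ (middle , zero)

ring-last : ∀ b r m → last (ring b r (suc m)) ≡ just (middle , zero)
ring-last b r m = last-∷ʳ (column b r ++ map shift (ring (exit b r) (ℕ.pred r) m))

mutual
  ring-linked : ∀ b r m → Linked (K 3 □ Path (suc m)) ((middle , zero) ∷ ring b r (suc m))
  ring-linked b zero    m = rung (outer≢middle b ∘ sym) ∷ shifted-ring-linked b zero m
  ring-linked b (suc r) m =
    rung (outer≢middle b ∘ sym) ∷ rung (outer≢outer-not b) ∷ shifted-ring-linked (not b) r m

  shifted-ring-linked : ∀ c r m →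
    Linked (K 3 □ Path (suc m)) ((outer c , zero) ∷ (map shift (ring c r m) ∷ʳ (middle , zero)))
  shifted-ring-linked c r zero    = rung (outer≢middle c) ∷ [-]
  shifted-ring-linked c r (suc m) =
    rail (inj₁ refl) ∷
    Linked-∷ʳ (Linked.map⁺ (Linked.map shift-hom (Linked.tail (ring-linked c r m))))
              (trans (last-map shift (ring c r (suc m))) (cong (Maybe.map shift) (ring-last c r m)))
              (rail (inj₂ refl))

shifted-off-zero : ∀ {m} (xs : List (Fin 3 × Fin m)) → All (λ v → proj₂ v ≢ zero) (map shift xs)
shifted-off-zero xs = All.map⁺ (universal (λ _ ()) xs)

column-at-zero : ∀ {m} b r → All (λ v → proj₁ v ≢ middle × proj₂ v ≡ zero) (column {m} b r)
column-at-zero b zero    = (outer≢middle b , refl) ∷ []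
column-at-zero b (suc _) = (outer≢middle b , refl) ∷ (outer≢middle (not b) , refl) ∷ []

column-unique : ∀ {m} b r → Unique (column {m} b r)
column-unique b zero    = [] ∷ []
column-unique b (suc _) = ((outer≢outer-not b ∘ cong proj₁) ∷ []) ∷ [] ∷ []

ring-unique : ∀ b r m → Unique (ring b r m)
ring-unique _ _ zero    = []
ring-unique b r (suc m) =
  Unique.++⁺
    (Unique.++⁺ (column-unique b r) (Unique.map⁺ shift-injective (ring-unique _ _ m)) column∩shifted)
    ([] ∷ [])
    (λ { (v∈ , here refl) → All.lookup ≢middle₀ v∈ refl })
  where
  shifted = map shift (ring (exit b r) (ℕ.pred r) m)

  column∩shifted : ∀ {v} → ¬ (v ∈ column b r × v ∈ shifted)
  column∩shifted (v∈col , v∈sh) =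
    All.lookup (shifted-off-zero _) v∈sh (proj₂ (All.lookup (column-at-zero b r) v∈col))

  ≢middle₀ : All (_≢ (middle , zero)) (column b r ++ shifted)
  ≢middle₀ = All.++⁺ (All.map (λ (c≢middle , _) → c≢middle ∘ cong proj₁) (column-at-zero b r))
                     (All.map (λ ≢zero → ≢zero ∘ cong proj₂) (shifted-off-zero _))

length-shifted-∷ʳ : ∀ {m} (xs : List (Fin 3 × Fin m)) {z} → length (map shift xs ∷ʳ z) ≡ suc (length xs)
length-shifted-∷ʳ xs =
  trans (length-++ (map shift xs)) (trans (+-comm _ 1) (cong suc (length-map shift xs)))

suc+suc : ∀ m x → suc m + suc m + x ≡ 2 + (m + m + x)
suc+suc m x = cong (λ y → suc (y + x)) (+-suc m m)

ring-length : ∀ b r m → r ≤ m → length (ring b r m) ≡ m + m + r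
ring-length _ _       zero    z≤n       = refl
ring-length b zero    (suc m) _         = begin
  1 + length (map shift R ∷ʳ (middle , zero)) ≡⟨ cong suc (length-shifted-∷ʳ R) ⟩
  2 + length R                                ≡⟨ cong (2 +_) (ring-length b zero m z≤n) ⟩
  2 + (m + m + 0)                             ≡⟨ suc+suc m 0 ⟨
  suc m + suc m + 0                           ∎
  where
  open ≡-Reasoning
  R = ring b zero m
ring-length b (suc r) (suc m) (s≤s r≤m) = begin
  2 + length (map shift R ∷ʳ (middle , zero)) ≡⟨ cong (2 +_) (length-shifted-∷ʳ R) ⟩
  3 + length R                                ≡⟨ cong (3 +_) (ring-length (not b) r m r≤m) ⟩
  3 + (m + m + r)                             ≡⟨ cong (2 +_) (+-suc (m + m) r) ⟨
  2 + (m + m + suc r)                         ≡⟨ suc+suc m (suc r) ⟨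
  suc m + suc m + suc r                       ∎
  where
  open ≡-Reasoning
  R = ring (not b) r m

cycle-cff-lift : ∀ {m r t} → r ≤ m → HasGCFF (Cycle m) t → HasGCFF (Cycle (m + m + r)) (3 + t)
cycle-cff-lift {zero}  z≤n _ = (λ ()) , λ ()
cycle-cff-lift {suc m} {r} {t} r≤m (B , cff) =
  subst (λ n → HasGCFF (Cycle n) (3 + t)) (ring-length false r (suc m) r≤m)
    (layered 3 B ∘ lookup walk , IsCFF-comap (lookup walk) walk-injective walk-hom layered-cff)
  where
  walk = ring false r (suc m)

  walk-injective : ∀ {i j} → lookup walk i ≡ lookup walk j → i ≡ j
  walk-injective = lookup-injective (ring-unique false r (suc m))

  walk-hom : ∀ {i j} → Cycle (length walk) i j → (K 3 □ Path (suc m)) (lookup walk i) (lookup walk j)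
  walk-hom = closed-walk-hom (K□-sym {E = Path (suc m)} 3 Path-sym)
                             (ring-linked false r m) (ring-last false r m)

  layered-cff : IsCFF (K 3 □ Path (suc m)) (3 + t) (layered 3 B)
  layered-cff =
    IsCFF-K□ 3 B (IsCFF⇒IsAntichain Fin._≟_ Cycle-neighbour cff) (IsCFF-comap id id inj₁ cff)

cff-C₃ : HasGCFF (Cycle 3) 3
cff-C₃ = ⁅_⁆ , from-yes (IsGCFF? (Cycle? 3) 3 ⁅_⁆)

cff-C₄ : HasGCFF (Cycle 4) 4
cff-C₄ = ⁅_⁆ , from-yes (IsGCFF? (Cycle? 4) 4 ⁅_⁆)

cff-C₅ : HasGCFF (Cycle 5) 5
cff-C₅ = ⁅_⁆ , from-yes (IsGCFF? (Cycle? 5) 5 ⁅_⁆)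

cff-C₆ : HasGCFF (Cycle 6) 5
cff-C₆ = blocks , from-yes (IsGCFF? (Cycle? 6) 5 blocks)
  where
  blocks : Fin 6 → Subset 5
  blocks = Vec.lookup (⁅ # 0 ⁆ ∪ ⁅ # 2 ⁆ ∷ ⁅ # 0 ⁆ ∪ ⁅ # 3 ⁆ ∷ ⁅ # 0 ⁆ ∪ ⁅ # 4 ⁆ ∷
                       ⁅ # 1 ⁆ ∪ ⁅ # 4 ⁆ ∷ ⁅ # 1 ⁆ ∪ ⁅ # 3 ⁆ ∷ ⁅ # 1 ⁆ ∪ ⁅ # 2 ⁆ ∷ [])

cycle-cff-2<n≤3 : ∀ {n} → 2 < n → n ≤ 3 → HasGCFF (Cycle n) 3
cycle-cff-2<n≤3 2<n n≤3 rewrite ≤-antisym n≤3 2<n = cff-C₃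

cycle-cff-3<n≤4 : ∀ {n} → 3 < n → n ≤ 4 → HasGCFF (Cycle n) 4
cycle-cff-3<n≤4 3<n n≤4 rewrite ≤-antisym n≤4 3<n = cff-C₄

cycle-cff-4<n≤6 : ∀ {n} → 4 < n → n ≤ 6 → HasGCFF (Cycle n) 5
cycle-cff-4<n≤6 4<n n≤6 with m≤n⇒m<n∨m≡n n≤6
... | inj₁ n<6  rewrite ≤-antisym (≤-pred n<6) 4<n = cff-C₅
... | inj₂ refl = cff-C₆

double-to-triple : ∀ {m n} → m + m ≤ n → n ≤ m + m + m → ∃ λ r → r ≤ m × m + m + r ≡ n
double-to-triple {m} {n} 2m≤n n≤3m =
    n ∸ (m + m)
  , subst (n ∸ (m + m) ≤_) (m+n∸m≡n (m + m) m) (∸-monoˡ-≤ (m + m) n≤3m)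
  , m+[n∸m]≡n 2m≤n

-- The step from level j to j + 1 lifts from m = b·3^j, the top of the previous interval:
-- 2m ≤ 3a·3^j < n ≤ 3m.
cycle-cff-interval : ∀ {a b T} → a < b → 2 * b ≤ 3 * a →
                     (∀ {n} → a < n → n ≤ b → HasGCFF (Cycle n) T) →
                     ∀ j {n} → a * 3 ^ j < n → n ≤ b * 3 ^ j → HasGCFF (Cycle n) (3 * j + T)
cycle-cff-interval {a} {b} _ _ base zero {n} lo hi =
  base (subst (_< n) (*-identityʳ a) lo) (subst (n ≤_) (*-identityʳ b) hi)
cycle-cff-interval {a} {b} {T} a<b 2b≤3a base (suc j) {n} lo hi =
  let r , r≤m , m+m+r≡n = double-to-triple m+m≤n n≤m+m+m in
  subst₂ (λ n t → HasGCFF (Cycle n) t) m+m+r≡n (cong (_+ T) (sym (*-suc 3 j)))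
    (cycle-cff-lift r≤m (cycle-cff-interval a<b 2b≤3a base j (*-monoˡ-< x a<b) ≤-refl))
  where
  x = 3 ^ j
  instance _ = m^n≢0 3 j
  m = b * x

  m+m≤n : m + m ≤ n
  m+m≤n = begin
    b * x + b * x ≡⟨ twice b x ⟩
    2 * b * x     ≤⟨ *-monoˡ-≤ x 2b≤3a ⟩
    3 * a * x     ≡⟨ thrice a x ⟩
    a * (3 * x)   <⟨ lo ⟩
    n             ∎
    where
    open ≤-Reasoning
    twice : ∀ b x → b * x + b * x ≡ 2 * b * x
    twice = solve-∀
    thrice : ∀ a x → 3 * a * x ≡ a * (3 * x)
    thrice = solve-∀

  n≤m+m+m : n ≤ m + m + m
  n≤m+m+m = ≤-trans hi (≤-reflexive (thrice b x))
    where
    thrice : ∀ b x → b * (3 * x) ≡ b * x + b * x + b * x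
    thrice = solve-∀

theorem6p12 : ∀ (n : ℕ) → 3 ≤ n → ∀ (tP tC : ℕ) → IsTG (Path n) tP → IsTG (Cycle n) tC →
      ((k : ℕ) → 1 ≤ k → 2 * 3 ^ (k ∸ 1) < n → n ≤ 3 ^ k →
        tP ≤ tC × tC ≤ 3 * k)
      × ((k : ℕ) → 1 ≤ k → 3 ^ k < n → n ≤ 4 * 3 ^ (k ∸ 1) →
        tP ≤ tC × tC ≤ 3 * k + 1)
      × ((k : ℕ) → 1 ≤ k → 4 * 3 ^ (k ∸ 1) < n → n ≤ 2 * 3 ^ k →
        tP ≤ tC × tC ≤ 3 * k + 2)
theorem6p12 n _ tP tC (_ , tP-minimal) ((B , cff) , tC-minimal) =
    (λ { (suc j) _ lo hi → tP≤tC , tC≤ (trans (level j 0) (+-identityʳ _))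
           (cycle-cff-interval (from-yes (2 <? 3)) (from-yes (6 ≤? 6)) cycle-cff-2<n≤3 j lo hi) })
  , (λ { (suc j) _ lo hi → tP≤tC , tC≤ (level j 1)
           (cycle-cff-interval (from-yes (3 <? 4)) (from-yes (8 ≤? 9)) cycle-cff-3<n≤4 j lo hi) })
  , (λ { (suc j) _ lo hi → tP≤tC , tC≤ (level j 2)
           (cycle-cff-interval (from-yes (4 <? 6)) (from-yes (12 ≤? 12)) cycle-cff-4<n≤6 j lo
             (subst (n ≤_) (sym (*-assoc 2 3 (3 ^ j))) hi)) })
  where
  tP≤tC : tP ≤ tC
  tP≤tC = tP-minimal tC (B , IsCFF-comap id id inj₁ cff)

  tC≤ : ∀ {s t} → s ≡ t → HasGCFF (Cycle n) s → tC ≤ t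
  tC≤ refl = tC-minimal _

  level : ∀ j c → 3 * j + (3 + c) ≡ 3 * suc j + c
  level = solve-∀
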